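{- Let $p$ be prime and let $c$ be a rainbow-free $r$-coloring of $\mathbb{Z}_p$ with respect to Schur triples, where $r>2$. Then $c(x)=c(-x)$ for all $x\in\mathbb{Z}_p$.
   Context: An $r$-coloring of $\mathbb{Z}_p$ is a surjective map $c:\mathbb{Z}_p\to\{1,\dots,r\}$. A Schur triple is $(x_1,x_2,x_3)\in\mathbb{Z}_p^3$ with $x_1+x_2\equiv x_3\pmod p$; it is rainbow under $c$ if $c(x_1),c(x_2),c(x_3)$ are pairwise distinct, and $c$ is rainbow-free if no Schur triple is rainbow. -}

module Defs where

open import Data.Nat using (ℕ; _+_; _∸_; NonZero)
open import Data.Nat.DivMod using (_mod_)
open import Data.Empty using (⊥)
open import Data.Fin using (Fin; toℕ)
open import Data.Product using (Σ; ∃; _×_)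
open import Relation.Binary.PropositionalEquality using (_≡_; _≢_)

-- ℤ_p is represented by Fin p (residues 0 … p-1).

_+ₚ_ : {p : ℕ} .{{_ : NonZero p}} → Fin p → Fin p → Fin p
_+ₚ_ {p} x y = (toℕ x + toℕ y) mod p

-ₚ_ : {p : ℕ} .{{_ : NonZero p}} → Fin p → Fin p
-ₚ_ {p} x = (p ∸ toℕ x) mod p

-- an r-coloring is a surjective map ℤ_p → {1,…,r} (here Fin r)
Surjective : {p r : ℕ} → (Fin p → Fin r) → Set
Surjective {p} {r} c = (k : Fin r) → ∃ λ x → c x ≡ k

RainbowSchur : {p r : ℕ} .{{_ : NonZero p}} → (Fin p → Fin r) → Fin p → Fin p → Fin p → Set
RainbowSchur c x₁ x₂ x₃ =
  (x₁ +ₚ x₂ ≡ x₃) × (c x₁ ≢ c x₂) × (c x₁ ≢ c x₃) × (c x₂ ≢ c x₃)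

RainbowFree : {p r : ℕ} .{{_ : NonZero p}} → (Fin p → Fin r) → Set
RainbowFree c = ∀ x₁ x₂ x₃ → RainbowSchur c x₁ x₂ x₃ → ⊥

module Submission where

-- Suppose c(x) = A and c(-x) = B with A ≠ B.  Since r > 2 there is a
-- third colour C, attained at some z.  The colour C propagates along x: if
-- c(w) = C then c(x + w) = C, for otherwise either (-x, x + w, w) is a rainbow
-- Schur triple with colours B, A, C, or (x, w, x + w) is one with colours A, C
-- and a colour different from A and C.  As A ≠ B forces x ≠ 0 and p is prime,
-- x is a unit of ℤ_p, so the progression z, z + x, z + 2x, … covers ℤ_p and
-- in particular reaches x; hence c(x) = C, a contradiction.

open import Defs
open import Data.Nat using (ℕ; zero; suc; _+_; _*_; _∸_; _%_; _<_; _>_; pred; NonZero; s≤s; ≢-nonZero)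
open import Data.Nat.Properties using (+-identityʳ; +-comm; +-assoc; *-identityʳ; m∸n+n≡m; <⇒≤; suc-pred)
open import Data.Nat.DivMod using (_mod_; m%n<n; m%n%n≡m%n; m<n⇒m%n≡m; [m+n]%n≡m%n; [m+kn]%n≡m%n; %-distribˡ-+; %-distribˡ-*)
open import Data.Nat.GCD using (module Bézout)
open import Data.Nat.Coprimality using (prime⇒coprime; coprime-Bézout)
open import Data.Nat.Primality using (Prime; prime⇒nonZero)
open import Data.Nat.Tactic.RingSolver using (solve-∀)
open import Data.Fin using (Fin; toℕ; zero; suc)
open import Data.Fin.Properties using (toℕ-fromℕ<; toℕ-injective; toℕ<n; _≟_)
open import Data.Product using (∃; _×_; _,_)
open import Data.Empty using (⊥-elim)
open import Relation.Nullary using (yes; no)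
open import Relation.Nullary.Decidable using (decidable-stable)
open import Relation.Binary.PropositionalEquality using (_≡_; _≢_; refl; sym; trans; cong; cong₂; subst; module ≡-Reasoning)

third-element : ∀ {n} → 2 < n → (a b : Fin n) → ∃ λ k → k ≢ a × k ≢ b
third-element (s≤s (s≤s (s≤s _))) = avoid
  where
  avoid : ∀ {m} (a b : Fin (suc (suc (suc m)))) → ∃ λ k → k ≢ a × k ≢ b
  avoid zero          zero          = suc zero , (λ ()) , (λ ())
  avoid zero          (suc zero)    = suc (suc zero) , (λ ()) , (λ ())
  avoid zero          (suc (suc _)) = suc zero , (λ ()) , (λ ())
  avoid (suc zero)    zero          = suc (suc zero) , (λ ()) , (λ ())
  avoid (suc zero)    (suc _)       = zero , (λ ()) , (λ ())
  avoid (suc (suc _)) zero          = suc zero , (λ ()) , (λ ())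
  avoid (suc (suc _)) (suc _)       = zero , (λ ()) , (λ ())

module _ {P : ℕ} .{{_ : NonZero P}} where

  infix 4 _≡ₘ_
  _≡ₘ_ : ℕ → ℕ → Set
  m ≡ₘ n = m % P ≡ n % P

  +-congₘ : ∀ {a b c d} → a ≡ₘ b → c ≡ₘ d → a + c ≡ₘ b + d
  +-congₘ {a} {b} {c} {d} a≡b c≡d = begin
    (a + c) % P            ≡⟨ %-distribˡ-+ a c P ⟩
    (a % P + c % P) % P    ≡⟨ cong₂ (λ u v → (u + v) % P) a≡b c≡d ⟩
    (b % P + d % P) % P    ≡⟨ %-distribˡ-+ b d P ⟨
    (b + d) % P            ∎
    where open ≡-Reasoning

  *-congₘ : ∀ {a b c d} → a ≡ₘ b → c ≡ₘ d → a * c ≡ₘ b * d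
  *-congₘ {a} {b} {c} {d} a≡b c≡d = begin
    (a * c) % P            ≡⟨ %-distribˡ-* a c P ⟩
    (a % P * (c % P)) % P  ≡⟨ cong₂ (λ u v → (u * v) % P) a≡b c≡d ⟩
    (b % P * (d % P)) % P  ≡⟨ %-distribˡ-* b d P ⟨
    (b * d) % P            ∎
    where open ≡-Reasoning

  [_] : ℕ → Fin P
  [ m ] = m mod P

  toℕ-[] : ∀ m → toℕ [ m ] ≡ₘ m
  toℕ-[] m = trans (cong (_% P) (toℕ-fromℕ< (m%n<n m P))) (m%n%n≡m%n m P)

  []-cong : ∀ {m n} → m ≡ₘ n → [ m ] ≡ [ n ]
  []-cong {m} {n} m≡n = toℕ-injective (begin
    toℕ [ m ]  ≡⟨ toℕ-fromℕ< (m%n<n m P) ⟩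
    m % P      ≡⟨ m≡n ⟩
    n % P      ≡⟨ toℕ-fromℕ< (m%n<n n P) ⟨
    toℕ [ n ]  ∎)
    where open ≡-Reasoning

  []-toℕ : (x : Fin P) → [ toℕ x ] ≡ x
  []-toℕ x = toℕ-injective (trans (toℕ-fromℕ< (m%n<n (toℕ x) P)) (m<n⇒m%n≡m (toℕ<n x)))

  []-+ : ∀ m n → [ m ] +ₚ [ n ] ≡ [ m + n ]
  []-+ m n = []-cong (+-congₘ (toℕ-[] m) (toℕ-[] n))

  -ₚ-cancel : (x w : Fin P) → (-ₚ x) +ₚ (x +ₚ w) ≡ w
  -ₚ-cancel x w = begin
    [ P ∸ X ] +ₚ [ X + W ]    ≡⟨ []-+ (P ∸ X) (X + W) ⟩
    [ (P ∸ X) + (X + W) ]     ≡⟨ cong [_] rearrange ⟩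
    [ W + P ]                 ≡⟨ []-cong ([m+n]%n≡m%n W P) ⟩
    [ W ]                     ≡⟨ []-toℕ w ⟩
    w                         ∎
    where
    open ≡-Reasoning
    X W : ℕ
    X = toℕ x
    W = toℕ w
    rearrange : (P ∸ X) + (X + W) ≡ W + P
    rearrange = begin
      (P ∸ X) + (X + W)  ≡⟨ +-assoc (P ∸ X) X W ⟨
      (P ∸ X + X) + W    ≡⟨ cong (_+ W) (m∸n+n≡m (<⇒≤ (toℕ<n x))) ⟩
      P + W              ≡⟨ +-comm P W ⟩
      W + P              ∎

  -ₚ-zero : (x : Fin P) → toℕ x ≡ 0 → -ₚ x ≡ x
  -ₚ-zero x x≡0 = begin
    [ P ∸ toℕ x ]  ≡⟨ cong (λ t → [ P ∸ t ]) x≡0 ⟩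
    [ 0 + P ]      ≡⟨ []-cong ([m+n]%n≡m%n 0 P) ⟩
    [ 0 ]          ≡⟨ cong [_] x≡0 ⟨
    [ toℕ x ]      ≡⟨ []-toℕ x ⟩
    x              ∎
    where open ≡-Reasoning

  Unit : Fin P → Set
  Unit x = ∃ λ n → n * toℕ x ≡ₘ 1

  prime⇒unit : Prime P → (x : Fin P) → toℕ x ≢ 0 → Unit x
  prime⇒unit pr x x≢0 = from-Bézout (coprime-Bézout (prime⇒coprime pr {{≢-nonZero x≢0}} (toℕ<n x)))
    where
    X : ℕ
    X = toℕ x
    from-Bézout : Bézout.Identity 1 P X → Unit x
    from-Bézout (Bézout.-+ a y 1+aP≡yX) = y , (begin
      (y * X) % P      ≡⟨ cong (_% P) 1+aP≡yX ⟨
      (1 + a * P) % P  ≡⟨ [m+kn]%n≡m%n 1 a P ⟩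
      1 % P            ∎)
      where open ≡-Reasoning
    from-Bézout (Bézout.+- a y 1+yX≡aP) = pred P * y , (begin
      (n * X) % P                ≡⟨ [m+kn]%n≡m%n (n * X) a P ⟨
      (n * X + a * P) % P        ≡⟨ cong (λ t → (n * X + t) % P) 1+yX≡aP ⟨
      (n * X + (1 + y * X)) % P  ≡⟨ cong (_% P) (collect (pred P) y X) ⟩
      (1 + y * X * suc (pred P)) % P  ≡⟨ cong (λ t → (1 + y * X * t) % P) (suc-pred P) ⟩
      (1 + y * X * P) % P        ≡⟨ [m+kn]%n≡m%n 1 (y * X) P ⟩
      1 % P                      ∎)
      where
      open ≡-Reasoning
      n : ℕ
      n = pred P * y
      collect : ∀ q y X → q * y * X + (1 + y * X) ≡ 1 + y * X * suc q
      collect = solve-∀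

  -- A set of residues containing z and closed under adding a unit x is all of
  -- ℤ_P: it contains z + k·x for every k, and k = x⁻¹·(y - z) gives any y.
  unit-orbit-covers : {x z : Fin P} → Unit x → (S : Fin P → Set) →
                      (∀ w → S w → S (x +ₚ w)) → S z → ∀ y → S y
  unit-orbit-covers {x} {z} (n , nX≡1) S closed Sz y = subst S reaches-y (S-step (n * T))
    where
    X Z Y T : ℕ
    X = toℕ x
    Z = toℕ z
    Y = toℕ y
    T = Y + (P ∸ Z)

    step : ℕ → Fin P
    step k = [ Z + k * X ]

    step-zero : step 0 ≡ z
    step-zero = trans (cong [_] (+-identityʳ Z)) ([]-toℕ z)

    step-suc : ∀ k → x +ₚ step k ≡ step (suc k)
    step-suc k = trans ([]-cong (+-congₘ {X} refl (toℕ-[] (Z + k * X))))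
                       (cong [_] (shift Z X k))
      where
      shift : ∀ Z X k → X + (Z + k * X) ≡ Z + (X + k * X)
      shift = solve-∀

    S-step : ∀ k → S (step k)
    S-step zero    = subst S (sym step-zero) Sz
    S-step (suc k) = subst S (step-suc k) (closed (step k) (S-step k))

    reaches-y : step (n * T) ≡ y
    reaches-y = begin
      [ Z + n * T * X ]    ≡⟨ cong [_] (regroup Z n T X) ⟩
      [ Z + T * (n * X) ]  ≡⟨ []-cong (+-congₘ {Z} refl (*-congₘ {T} refl nX≡1)) ⟩
      [ Z + T * 1 ]        ≡⟨ cong [_] (trans (cong (Z +_) (*-identityʳ T)) (reorder Z Y (P ∸ Z))) ⟩
      [ Y + (P ∸ Z + Z) ]  ≡⟨ cong (λ t → [ Y + t ]) (m∸n+n≡m (<⇒≤ (toℕ<n z))) ⟩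
      [ Y + P ]            ≡⟨ []-cong ([m+n]%n≡m%n Y P) ⟩
      [ Y ]                ≡⟨ []-toℕ y ⟩
      y                    ∎
      where
      open ≡-Reasoning
      regroup : ∀ Z n T X → Z + n * T * X ≡ Z + T * (n * X)
      regroup = solve-∀
      reorder : ∀ Z Y D → Z + (Y + D) ≡ Y + (D + Z)
      reorder = solve-∀

  colour-propagates : ∀ {r} {c : Fin P → Fin r} → RainbowFree c →
                      {x : Fin P} → c x ≢ c (-ₚ x) →
                      {k : Fin r} → k ≢ c x → k ≢ c (-ₚ x) →
                      ∀ w → c w ≡ k → c (x +ₚ w) ≡ k
  colour-propagates {c = c} rf {x} cx≢c-x {k} k≢cx k≢c-x w cw≡k
    with c (x +ₚ w) ≟ k
  ... | yes cx+w≡k = cx+w≡k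
  ... | no cx+w≢k with c (x +ₚ w) ≟ c x
  ...   | yes cx+w≡cx =
    -- (-x, x + w, w) is rainbow with colours c(-x), c(x), k
    ⊥-elim (rf (-ₚ x) (x +ₚ w) w
      ( -ₚ-cancel x w
      , (λ e → cx≢c-x (sym (trans e cx+w≡cx)))
      , (λ e → k≢c-x (trans (sym cw≡k) (sym e)))
      , (λ e → cx+w≢k (trans e cw≡k))))
  ...   | no cx+w≢cx =
    -- (x, w, x + w) is rainbow with colours c(x), k, c(x + w)
    ⊥-elim (rf x w (x +ₚ w)
      ( refl
      , (λ e → k≢cx (trans (sym cw≡k) (sym e)))
      , (λ e → cx+w≢cx (sym e))
      , (λ e → cx+w≢k (trans (sym e) cw≡k))))

lemma4 : (p r : ℕ) (pr : Prime p) → r > 2 → (c : Fin p → Fin r) →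
    Surjective c → RainbowFree {{prime⇒nonZero pr}} c →
    (x : Fin p) → c x ≡ c (-ₚ_ {{prime⇒nonZero pr}} x)
lemma4 p r pr r>2 c surj rf x = decidable-stable (c x ≟ c (-ₚ x)) λ cx≢c-x →
  let
      k , k≢cx , k≢c-x = third-element r>2 (c x) (c (-ₚ x))
      z , cz≡k         = surj k
      -- x ≠ 0, since 0 = -0
      x≢0 : toℕ x ≢ 0
      x≢0 x≡0 = cx≢c-x (cong c (sym (-ₚ-zero x x≡0)))
      c≡k : ∀ y → c y ≡ k
      c≡k = unit-orbit-covers (prime⇒unit pr x x≢0) (λ w → c w ≡ k)
              (colour-propagates rf cx≢c-x k≢cx k≢c-x) cz≡k
  in k≢cx (sym (c≡k x))
  where instance _ = prime⇒nonZero pr
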